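{- Assume $F$ is dyadic. Let $B=\begin{pmatrix}b_{11}&b_{12}\\ b_{12}&b_{22}\end{pmatrix}\in\mathcal{M}((a_1,a_2))$ be nondegenerate with $a_1\le a_2$. (1) If $a_1=a_2$, then $\mathrm{GK}(B)=(a_1,a_2)$ iff $\mathrm{ord}(2b_{12})=a_1$. (2) If $a_2-a_1=2f$ with $f$ a positive integer, then $\mathrm{GK}(B)=(a_1,a_2)$ iff $\mathrm{ord}(b_{11})=a_1$ and $\mathrm{ord}(2b_{12})=a_1+f$. (3) If $a_2-a_1=2f+1$ with $f$ a non-negative integer, then $\mathrm{GK}(B)=(a_1,a_2)$ iff $\mathrm{ord}(b_{11})=a_1$ and $\mathrm{ord}(b_{22})=a_2$.
   Context: $F$ is a non-archimedean local field of characteristic $0$ whose residue field has characteristic $2$ (dyadic), ring of integers $\mathfrak{o}$, normalized valuation $\mathrm{ord}$. A half-integral symmetric $2\times2$ matrix has $b_{ii}\in\mathfrak{o}$, $2b_{12}\in\mathfrak{o}$. $\mathcal{M}((a_1,a_2))$ is the set of half-integral $B$ with $\mathrm{ord}(b_{11})\ge a_1$, $\mathrm{ord}(b_{22})\ge a_2$, $\mathrm{ord}(2b_{12})\ge(a_1+a_2)/2$. For nondegenerate $B$, $\mathrm{GK}(B)$ is the lexicographically greatest non-decreasing $(c_1,c_2)\in\mathbb{Z}_{\ge0}^2$ such that ${}^tUBU\in\mathcal{M}((c_1,c_2))$ for some $U\in\mathrm{GL}_2(\mathfrak{o})$. -}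

module Defs where

open import Level using (Level; _⊔_) renaming (suc to lsuc)
open import Algebra.Bundles using (CommutativeRing)
open import Data.Nat as ℕ using (ℕ; zero; suc)
open import Data.Integer as ℤ using (ℤ; +_; _⊓_)
open import Data.Fin using (Fin)
open import Data.Product using (Σ; ∃; _×_; _,_)
open import Data.Sum using (_⊎_)
open import Relation.Nullary using (¬_)
open import Relation.Binary.PropositionalEquality using (_≡_)

module _ {c ℓ} (R : CommutativeRing c ℓ) where
  open CommutativeRing R
  natF : ℕ → Carrier
  natF zero = 0#
  natF (suc n) = 1# + natF n

-- A dyadic non-archimedean local field of characteristic 0:
-- a field with a normalized discrete valuation ord (values on nonzero
-- elements; the value at 0 is irrelevant and never used, ord 0 = ∞ is
-- encoded by the predicates OrdGE / OrdEq below), complete w.r.t. ord,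
-- with finite residue field o/p of characteristic 2.
record DyadicLocalField (c ℓ : Level) : Set (lsuc (c ⊔ ℓ)) where
  field
    cring : CommutativeRing c ℓ
  open CommutativeRing cring public
  field
    1≉0     : ¬ (1# ≈ 0#)
    inverse : ∀ x → ¬ (x ≈ 0#) → ∃ λ y → x * y ≈ 1#
    ord     : Carrier → ℤ
    ord-cong : ∀ {x y} → x ≈ y → ¬ (x ≈ 0#) → ord x ≡ ord y
    ord-mul : ∀ x y → ¬ (x ≈ 0#) → ¬ (y ≈ 0#) → ord (x * y) ≡ ord x ℤ.+ ord y
    ord-add : ∀ x y → ¬ (x ≈ 0#) → ¬ (y ≈ 0#) → ¬ ((x + y) ≈ 0#) →
              (ord x ⊓ ord y) ℤ.≤ ord (x + y)
    -- normalized: ord is onto ℤ (a uniformizer exists)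
    uniformizer : ∃ λ π → ¬ (π ≈ 0#) × ord π ≡ + 1

  OrdGE : Carrier → ℤ → Set ℓ
  OrdGE x n = (x ≈ 0#) ⊎ (¬ (x ≈ 0#) × n ℤ.≤ ord x)

  OrdEq : Carrier → ℤ → Set ℓ
  OrdEq x n = ¬ (x ≈ 0#) × ord x ≡ n

  Int : Carrier → Set ℓ
  Int x = OrdGE x (+ 0)

  field
    char0 : ∀ n → ¬ (natF cring (suc n) ≈ 0#)
    dyadic : OrdGE (1# + 1#) (+ 1)
    -- finite residue field: finitely many representatives of o / p
    residueFinite : Σ ℕ λ k → Σ (Fin k → Carrier) λ r →
                      (∀ i → Int (r i)) ×
                      (∀ x → Int x → Σ (Fin k) λ i → OrdGE (x - r i) (+ 1))
    complete : ∀ (s : ℕ → Carrier) →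
      (∀ (n : ℕ) → ∃ λ N → ∀ m k → N ℕ.≤ m → N ℕ.≤ k → OrdGE (s m - s k) (+ n)) →
      ∃ λ L → ∀ (n : ℕ) → ∃ λ N → ∀ m → N ℕ.≤ m → OrdGE (s m - L) (+ n)

record Sym2 {c} (A : Set c) : Set c where
  constructor sym2
  field b11 b12 b22 : A

record Mat2 {c} (A : Set c) : Set c where
  constructor mat2
  field u11 u12 u21 u22 : A

module DLF {c ℓ} (K : DyadicLocalField c ℓ) where
  open DyadicLocalField K
  open Sym2
  open Mat2

  two : Carrier
  two = 1# + 1#

  HalfIntegral : Sym2 Carrier → Set ℓ
  HalfIntegral B = Int (b11 B) × Int (b22 B) × Int (two * b12 B)

  Nondegenerate : Sym2 Carrier → Set ℓ
  Nondegenerate B = ¬ ((b11 B * b22 B - b12 B * b12 B) ≈ 0#)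

  -- B ∈ M((a1,a2)); the condition ord(2 b12) ≥ (a1+a2)/2 is written
  -- as 2·ord(2 b12) ≥ a1 + a2 (or 2 b12 = 0)
  InM : Sym2 Carrier → ℕ → ℕ → Set ℓ
  InM B a1 a2 = HalfIntegral B × OrdGE (b11 B) (+ a1) × OrdGE (b22 B) (+ a2) ×
    ((two * b12 B ≈ 0#) ⊎
     (¬ (two * b12 B ≈ 0#) × + (a1 ℕ.+ a2) ℤ.≤ (+ 2) ℤ.* ord (two * b12 B)))

  InGL2o : Mat2 Carrier → Set ℓ
  InGL2o U = Int (u11 U) × Int (u12 U) × Int (u21 U) × Int (u22 U) ×
             OrdEq (u11 U * u22 U - u12 U * u21 U) (+ 0)

  -- ᵗU B U
  congr : Mat2 Carrier → Sym2 Carrier → Sym2 Carrier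
  congr (mat2 x11 x12 x21 x22) (sym2 p q r) = sym2
    (x11 * x11 * p + two * x11 * x21 * q + x21 * x21 * r)
    (x11 * x12 * p + (x11 * x22 + x21 * x12) * q + x21 * x22 * r)
    (x12 * x12 * p + two * x12 * x22 * q + x22 * x22 * r)

  Reach : Sym2 Carrier → ℕ → ℕ → Set (c ⊔ ℓ)
  Reach B d1 d2 = Σ (Mat2 Carrier) λ U → InGL2o U × InM (congr U B) d1 d2

  LexLE : ℕ → ℕ → ℕ → ℕ → Set
  LexLE d1 d2 c1 c2 = (d1 ℕ.< c1) ⊎ ((d1 ≡ c1) × (d2 ℕ.≤ c2))

  IsGK : Sym2 Carrier → ℕ → ℕ → Set (c ⊔ ℓ)
  IsGK B c1 c2 = (c1 ℕ.≤ c2) × Reach B c1 c2 ×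
    (∀ d1 d2 → d1 ℕ.≤ d2 → Reach B d1 d2 → LexLE d1 d2 c1 c2)

  twice : Carrier → Carrier
  twice x = two * x

{-# OPTIONS --safe #-}
module Submission where

open import Defs
open import Level using (Level)
open import Algebra.Bundles using (CommutativeRing)
open import Algebra.Solver.Ring.AlmostCommutativeRing
  using (_-Raw-AlmostCommutative⟶_; fromCommutativeRing)
open import Data.Fin as Fin using (Fin; toℕ)
import Data.Fin.Properties as Finₚ
open import Data.Integer as ℤ using (ℤ; +_; -[1+_]; _⊖_; _◃_)
import Data.Integer.Properties as ℤₚ
import Data.Integer.Tactic.RingSolver as ℤ-Tactic
open import Data.Maybe using (Maybe; just; nothing)
open import Data.Nat as ℕ using (ℕ; zero; suc; _≤_; _<_; z≤n; s≤s)
  renaming (_+_ to _+ℕ_; _*_ to _*ℕ_)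
import Data.Nat.Properties as ℕₚ
import Data.Nat.Tactic.RingSolver as ℕ-Tactic
open import Data.Product using (Σ; ∃₂; _×_; _,_; proj₁; proj₂)
open import Data.Sign as Sign using (Sign)
open import Data.Sum using (_⊎_; inj₁; inj₂)
open import Function using (_∘_)
open import Function.Bundles using (_⇔_; mk⇔)
open import Relation.Binary.Definitions using (tri<; tri≈; tri>)
open import Relation.Binary.PropositionalEquality as ≡ using (_≡_)
open import Relation.Nullary using (¬_; yes; no)
open import Relation.Nullary.Decidable using (decidable-stable)
open import Relation.Nullary.Negation using (contradiction; ¬¬-map)

-- GK(B) is bounded by invariants of GL₂(𝔬)-equivalence.  The discriminant (2b₁₂)² − 4b₁₁b₂₂ only
-- changes by a unit square, so if an equivalent form lies in M((d₁,d₂)) then ord(disc B) ≥ d₁ + d₂;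
-- if moreover d₁ ≤ d₂, all entries of that form, hence all entries of B, lie in 𝔭^d₁.  When
-- a₂ − a₁ = 2f + 1 is odd, b₁₁x² + 2b₁₂xy + b₂₂y² ∉ 𝔭^(a₂+1) for every primitive (x, y), because
-- b₁₁x² and b₂₂y² have valuations of different parity; this bounds the second diagonal entry of an
-- equivalent form.  Conversely, when a condition fails, a lexicographically larger pair is reached
-- by the identity, by exchanging b₁₁ and b₂₂, or, when ord b₁₁ = a₁, ord b₂₂ = a₁ + 2f and
-- ord(2b₁₂) > a₁ + f, by the shear (1 x; 0 1) with x = πᶠy and y² ≡ b₂₂/(b₁₁π²ᶠ) mod 𝔭.  Such a y
-- exists because squaring is a bijection of the finite residue field of characteristic 2, and the
-- sheared b₂₂ is then ≡ 2b₂₂ ≡ 0 modulo 𝔭^(a₂+1).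

module ℤ-Solver {c ℓ} (R : CommutativeRing c ℓ) where
  open CommutativeRing R
  open import Algebra.Properties.Ring ring
  open import Algebra.Properties.Semiring.Mult.TCOptimised semiring
    using (1+×; ×-homo-+; ×1-homo-*) renaming (_×_ to _×′_)
  open import Algebra.Properties.CommutativeSemigroup *-commutativeSemigroup using (interchange)
  open import Relation.Binary.Reasoning.Setoid setoid

  private
    -- With the optimised _×′_, 2 ×′ 1# is 1# + 1#, so the solver's constant 2 is definitionally `two`.
    fromℤ : ℤ → Carrier
    fromℤ (+ n)     = n ×′ 1#
    fromℤ -[1+ n ] = - (suc n ×′ 1#)

    [1+x]-[1+y]≈x-y : ∀ x y → (1# + x) - (1# + y) ≈ x - y
    [1+x]-[1+y]≈x-y x y = begin
      (1# + x) + - (1# + y)    ≈⟨ +-congˡ (-‿+-comm 1# y) ⟨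
      (1# + x) + (- 1# + - y)  ≈⟨ +-congʳ (+-comm 1# x) ⟩
      (x + 1#) + (- 1# + - y)  ≈⟨ +-assoc x 1# _ ⟩
      x + (1# + (- 1# + - y))  ≈⟨ +-congˡ (+-assoc 1# (- 1#) (- y)) ⟨
      x + ((1# - 1#) + - y)    ≈⟨ +-congˡ (+-congʳ (-‿inverseʳ 1#)) ⟩
      x + (0# + - y)           ≈⟨ +-congˡ (+-identityˡ (- y)) ⟩
      x - y                    ∎

    fromℤ-⊖ : ∀ m n → fromℤ (m ⊖ n) ≈ m ×′ 1# - n ×′ 1#
    fromℤ-⊖ m zero = begin
      fromℤ (m ⊖ 0)  ≡⟨ ≡.cong fromℤ (ℤₚ.⊖-≥ {m} z≤n) ⟩
      m ×′ 1#         ≈⟨ +-identityʳ _ ⟨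
      m ×′ 1# + 0#    ≈⟨ +-congˡ -0#≈0# ⟨
      m ×′ 1# - 0#    ∎
    fromℤ-⊖ zero    (suc n) = sym (+-identityˡ _)
    fromℤ-⊖ (suc m) (suc n) = begin
      fromℤ (suc m ⊖ suc n)          ≡⟨ ≡.cong fromℤ (ℤₚ.[1+m]⊖[1+n]≡m⊖n m n) ⟩
      fromℤ (m ⊖ n)                  ≈⟨ fromℤ-⊖ m n ⟩
      m ×′ 1# - n ×′ 1#                ≈⟨ [1+x]-[1+y]≈x-y _ _ ⟨
      (1# + m ×′ 1#) - (1# + n ×′ 1#)  ≈⟨ +-cong (1+× m 1#) (-‿cong (1+× n 1#)) ⟨
      suc m ×′ 1# - suc n ×′ 1#        ∎

    fromℤ-+ : ∀ i j → fromℤ (i ℤ.+ j) ≈ fromℤ i + fromℤ j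
    fromℤ-+ (+ m)    (+ n)    = ×-homo-+ 1# m n
    fromℤ-+ (+ m)    -[1+ n ] = fromℤ-⊖ m (suc n)
    fromℤ-+ -[1+ m ] (+ n)    = trans (fromℤ-⊖ n (suc m)) (+-comm _ _)
    fromℤ-+ -[1+ m ] -[1+ n ] = begin
      - (suc (suc (m +ℕ n)) ×′ 1#)      ≡⟨ ≡.cong (λ k → - (suc k ×′ 1#)) (ℕₚ.+-suc m n) ⟨
      - ((suc m +ℕ suc n) ×′ 1#)        ≈⟨ -‿cong (×-homo-+ 1# (suc m) (suc n)) ⟩
      - (suc m ×′ 1# + suc n ×′ 1#)      ≈⟨ -‿+-comm _ _ ⟨
      - (suc m ×′ 1#) + - (suc n ×′ 1#)  ∎

    fromSign : Sign → Carrier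
    fromSign Sign.+ = 1#
    fromSign Sign.- = - 1#

    fromSign-* : ∀ s t → fromSign (s Sign.* t) ≈ fromSign s * fromSign t
    fromSign-* Sign.+ t      = sym (*-identityˡ _)
    fromSign-* Sign.- Sign.+ = sym (*-identityʳ _)
    fromSign-* Sign.- Sign.- = begin
      1#             ≈⟨ -‿involutive 1# ⟨
      - - 1#         ≈⟨ -‿cong (-1*x≈-x 1#) ⟨
      - (- 1# * 1#)  ≈⟨ -‿distribʳ-* (- 1#) 1# ⟩
      - 1# * - 1#    ∎

    fromℤ-◃ : ∀ s n → fromℤ (s ◃ n) ≈ fromSign s * (n ×′ 1#)
    fromℤ-◃ s      zero    = sym (zeroʳ _)
    fromℤ-◃ Sign.+ (suc n) = sym (*-identityˡ _)
    fromℤ-◃ Sign.- (suc n) = sym (-1*x≈-x _)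

    fromℤ-sign-abs : ∀ i → fromℤ i ≈ fromSign (ℤ.sign i) * (ℤ.∣ i ∣ ×′ 1#)
    fromℤ-sign-abs i = trans (reflexive (≡.cong fromℤ (≡.sym (ℤₚ.◃-inverse i)))) (fromℤ-◃ (ℤ.sign i) ℤ.∣ i ∣)

    fromℤ-* : ∀ i j → fromℤ (i ℤ.* j) ≈ fromℤ i * fromℤ j
    fromℤ-* i j = begin
      fromℤ ((s Sign.* t) ◃ (m *ℕ n))              ≈⟨ fromℤ-◃ (s Sign.* t) (m *ℕ n) ⟩
      fromSign (s Sign.* t) * ((m *ℕ n) ×′ 1#)      ≈⟨ *-cong (fromSign-* s t) (×1-homo-* m n) ⟩
      (fromSign s * fromSign t) * (m ×′ 1# * n ×′ 1#) ≈⟨ interchange _ _ _ _ ⟩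
      (fromSign s * m ×′ 1#) * (fromSign t * n ×′ 1#) ≈⟨ *-cong (fromℤ-sign-abs i) (fromℤ-sign-abs j) ⟨
      fromℤ i * fromℤ j                            ∎
      where s = ℤ.sign i; t = ℤ.sign j; m = ℤ.∣ i ∣; n = ℤ.∣ j ∣

    fromℤ-neg : ∀ i → fromℤ (ℤ.- i) ≈ - fromℤ i
    fromℤ-neg (+ zero)  = sym -0#≈0#
    fromℤ-neg (+ suc n) = refl
    fromℤ-neg -[1+ n ]  = sym (-‿involutive _)

    homomorphism : ℤ.+-*-rawRing -Raw-AlmostCommutative⟶ fromCommutativeRing R
    homomorphism = record
      { ⟦_⟧ = fromℤ ; +-homo = fromℤ-+ ; *-homo = fromℤ-* ; -‿homo = fromℤ-neg
      ; 0-homo = refl ; 1-homo = refl }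

    fromℤ-≟ : ∀ i j → Maybe (fromℤ i ≈ fromℤ j)
    fromℤ-≟ i j with i ℤ.≟ j
    ... | yes ≡.refl = just refl
    ... | no _       = nothing

  open import Algebra.Solver.Ring ℤ.+-*-rawRing (fromCommutativeRing R) homomorphism fromℤ-≟ public

module Dyadic {c ℓ} (K : DyadicLocalField c ℓ) where
  open DyadicLocalField K
  open DLF K
  open Sym2
  open Mat2
  open import Algebra.Properties.Ring ring using (-0#≈0#; -‿involutive; -1*x≈-x)
  open import Algebra.Properties.CommutativeSemigroup *-commutativeSemigroup using (interchange)
  open import Algebra.Properties.Ring ℤₚ.+-*-ring using ()
    renaming (+-identityˡ-unique to ℤ-identityˡ-unique; +-identityʳ-unique to ℤ-identityʳ-unique)
  open import Algebra.Properties.Semiring.Exp semiring using (_^_)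
  open import Relation.Binary.Reasoning.Setoid setoid
  open ℤ-Solver cring using (Polynomial; solve; _:=_; _:+_; _:-_; _:*_; :-_; con)

  private
    variable
      x y u : Carrier
      m n : ℕ

  -- Valuations

  *-nonzero : ¬ x ≈ 0# → ¬ y ≈ 0# → ¬ x * y ≈ 0#
  *-nonzero {x} {y} x≉0 y≉0 xy≈0 with inverse x x≉0 | inverse y y≉0
  ... | x⁻¹ , xx⁻¹≈1 | y⁻¹ , yy⁻¹≈1 = 1≉0 (begin
    1#                     ≈⟨ *-identityˡ 1# ⟨
    1# * 1#                ≈⟨ *-cong xx⁻¹≈1 yy⁻¹≈1 ⟨
    (x * x⁻¹) * (y * y⁻¹)  ≈⟨ interchange x x⁻¹ y y⁻¹ ⟩
    (x * y) * (x⁻¹ * y⁻¹)  ≈⟨ *-congʳ xy≈0 ⟩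
    0# * (x⁻¹ * y⁻¹)       ≈⟨ zeroˡ _ ⟩
    0#                     ∎)

  OrdEq-1# : OrdEq 1# (+ 0)
  OrdEq-1# = 1≉0 , ℤ-identityˡ-unique (ord 1#) (ord 1#)
    (≡.trans (≡.sym (ord-mul 1# 1# 1≉0 1≉0)) (ord-cong (*-identityˡ 1#) (*-nonzero 1≉0 1≉0)))

  OrdEq--1# : OrdEq (- 1#) (+ 0)
  OrdEq--1# = -1≉0 , i+i≡0⇒i≡0 (≡.trans (≡.sym (ord-mul (- 1#) (- 1#) -1≉0 -1≉0))
                                 (≡.trans (ord-cong -1*-1≈1 (*-nonzero -1≉0 -1≉0)) (proj₂ OrdEq-1#)))
    where
    -1*-1≈1 : - 1# * - 1# ≈ 1#
    -1*-1≈1 = solve 0 (:- con (+ 1) :* :- con (+ 1) := con (+ 1)) refl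
    -1≉0 : ¬ - 1# ≈ 0#
    -1≉0 -1≈0 = 1≉0 (trans (sym (-‿involutive 1#)) (trans (-‿cong -1≈0) -0#≈0#))
    i+i≡0⇒i≡0 : ∀ {i} → i ℤ.+ i ≡ + 0 → i ≡ + 0
    i+i≡0⇒i≡0 {+ k}      eq = ≡.cong +_ (ℕₚ.m+n≡0⇒m≡0 k (ℤₚ.+-injective eq))
    i+i≡0⇒i≡0 { -[1+ k ]} ()

  OrdEq-resp-≈ : ∀ {i} → x ≈ y → OrdEq x i → OrdEq y i
  OrdEq-resp-≈ x≈y (x≉0 , ord-x) = x≉0 ∘ trans x≈y , ≡.trans (≡.sym (ord-cong x≈y x≉0)) ord-x

  OrdEq-* : OrdEq x (+ m) → OrdEq y (+ n) → OrdEq (x * y) (+ (m +ℕ n))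
  OrdEq-* {x} {y = y} (x≉0 , ord-x) (y≉0 , ord-y) =
    *-nonzero x≉0 y≉0 , ≡.trans (ord-mul x y x≉0 y≉0) (≡.cong₂ ℤ._+_ ord-x ord-y)

  OrdEq⇒OrdGE : ∀ {i} → OrdEq x i → OrdGE x i
  OrdEq⇒OrdGE (x≉0 , ord-x) = inj₂ (x≉0 , ℤₚ.≤-reflexive (≡.sym ord-x))

  OrdGE-resp-≈ : ∀ {i} → x ≈ y → OrdGE x i → OrdGE y i
  OrdGE-resp-≈ x≈y (inj₁ x≈0)        = inj₁ (trans (sym x≈y) x≈0)
  OrdGE-resp-≈ x≈y (inj₂ (x≉0 , i≤)) = inj₂ (x≉0 ∘ trans x≈y , ≡.subst (_ ℤ.≤_) (ord-cong x≈y x≉0) i≤)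

  -- Unlike OrdGE it does not decide whether x ≈ 0#, so it is stable under double
  -- negation; the conclusions of the theorem are too, which is what allows the classical
  -- case analyses below.
  infix 4 _∈𝔭^_
  _∈𝔭^_ : Carrier → ℕ → Set ℓ
  x ∈𝔭^ n = ¬ x ≈ 0# → + n ℤ.≤ ord x

  ∈𝔭^-stable : ¬ ¬ x ∈𝔭^ n → x ∈𝔭^ n
  ∈𝔭^-stable {n = n} ¬¬x∈ x≉0 = decidable-stable (+ n ℤ.≤? _) (λ n≰ → ¬¬x∈ (λ x∈ → n≰ (x∈ x≉0)))

  OrdEq-stable : ∀ {i} → ¬ ¬ OrdEq x i → OrdEq x i
  OrdEq-stable {i = i} ¬¬eq =
    (λ x≈0 → ¬¬eq (λ eq → proj₁ eq x≈0)) , decidable-stable (ord _ ℤ.≟ i) (λ ord≢i → ¬¬eq (ord≢i ∘ proj₂))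

  OrdGE⇒∈𝔭^ : OrdGE x (+ n) → x ∈𝔭^ n
  OrdGE⇒∈𝔭^ (inj₁ x≈0)         x≉0 = contradiction x≈0 x≉0
  OrdGE⇒∈𝔭^ (inj₂ (_ , n≤ord)) _   = n≤ord

  ∈𝔭^⇒¬¬OrdGE : x ∈𝔭^ n → ¬ ¬ OrdGE x (+ n)
  ∈𝔭^⇒¬¬OrdGE x∈ ¬ge = ¬ge (inj₂ (x≉0 , x∈ x≉0))
    where x≉0 = ¬ge ∘ inj₁

  OrdEq⇒∈𝔭^ : OrdEq x (+ n) → x ∈𝔭^ n
  OrdEq⇒∈𝔭^ (_ , ord-x) _ = ℤₚ.≤-reflexive (≡.sym ord-x)

  ≈0⇒∈𝔭^ : x ≈ 0# → x ∈𝔭^ n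
  ≈0⇒∈𝔭^ x≈0 x≉0 = contradiction x≈0 x≉0

  ∈𝔭^-resp-≈ : x ≈ y → x ∈𝔭^ n → y ∈𝔭^ n
  ∈𝔭^-resp-≈ {n = n} x≈y x∈ y≉0 = ≡.subst (+ n ℤ.≤_) (ord-cong x≈y x≉0) (x∈ x≉0)
    where x≉0 = y≉0 ∘ trans (sym x≈y)

  ∈𝔭^-resp-≡ : m ≡ n → x ∈𝔭^ m → x ∈𝔭^ n
  ∈𝔭^-resp-≡ ≡.refl x∈ = x∈

  ∈𝔭^-weaken : m ≤ n → x ∈𝔭^ n → x ∈𝔭^ m
  ∈𝔭^-weaken m≤n x∈ x≉0 = ℤₚ.≤-trans (ℤ.+≤+ m≤n) (x∈ x≉0)

  ∈𝔭^-+ : x ∈𝔭^ n → y ∈𝔭^ n → x + y ∈𝔭^ n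
  ∈𝔭^-+ {x} {n} {y} x∈ y∈ = ∈𝔭^-stable λ ¬x+y∈ → ¬x+y∈ λ x+y≉0 →
    let x≉0 = λ x≈0 → ¬x+y∈ (∈𝔭^-resp-≈ (trans (sym (+-identityˡ y)) (+-congʳ (sym x≈0))) y∈)
        y≉0 = λ y≈0 → ¬x+y∈ (∈𝔭^-resp-≈ (trans (sym (+-identityʳ x)) (+-congˡ (sym y≈0))) x∈)
    in ℤₚ.≤-trans (ℤₚ.⊓-glb (x∈ x≉0) (y∈ y≉0)) (ord-add x y x≉0 y≉0 x+y≉0)

  ∈𝔭^-* : x ∈𝔭^ m → y ∈𝔭^ n → x * y ∈𝔭^ (m +ℕ n)
  ∈𝔭^-* {x} {y = y} x∈ y∈ xy≉0 =
    ≡.subst (_ ℤ.≤_) (≡.sym (ord-mul x y x≉0 y≉0)) (ℤₚ.+-mono-≤ (x∈ x≉0) (y∈ y≉0))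
    where
    x≉0 = λ x≈0 → xy≉0 (trans (*-congʳ x≈0) (zeroˡ y))
    y≉0 = λ y≈0 → xy≉0 (trans (*-congˡ y≈0) (zeroʳ x))

  ∈𝔭^-*ʳ : x ∈𝔭^ n → y ∈𝔭^ 0 → x * y ∈𝔭^ n
  ∈𝔭^-*ʳ {n = n} x∈ y∈ = ∈𝔭^-resp-≡ (ℕₚ.+-identityʳ n) (∈𝔭^-* x∈ y∈)

  -‿∈𝔭^ : x ∈𝔭^ n → - x ∈𝔭^ n
  -‿∈𝔭^ {x} x∈ = ∈𝔭^-resp-≈ (-1*x≈-x x) (∈𝔭^-* (OrdEq⇒∈𝔭^ OrdEq--1#) x∈)

  ∈𝔭^-- : x ∈𝔭^ n → y ∈𝔭^ n → x - y ∈𝔭^ n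
  ∈𝔭^-- x∈ y∈ = ∈𝔭^-+ x∈ (-‿∈𝔭^ y∈)

  2∈𝔭¹ : two ∈𝔭^ 1
  2∈𝔭¹ = OrdGE⇒∈𝔭^ dyadic

  4∈𝔭² : two * two ∈𝔭^ 2
  4∈𝔭² = ∈𝔭^-* 2∈𝔭¹ 2∈𝔭¹

  ∈𝔭^-unit-cancelˡ : OrdEq u (+ 0) → u * x ∈𝔭^ n → x ∈𝔭^ n
  ∈𝔭^-unit-cancelˡ {u} {x} (u≉0 , ord-u) ux∈ x≉0 = ≡.subst (_ ℤ.≤_)
    (≡.trans (ord-mul u x u≉0 x≉0) (≡.trans (≡.cong (ℤ._+ ord x) ord-u) (ℤₚ.+-identityˡ (ord x))))
    (ux∈ (*-nonzero u≉0 x≉0))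

  OrdEq⇒∉𝔭^suc : OrdEq x (+ n) → ¬ x ∈𝔭^ suc n
  OrdEq⇒∉𝔭^suc (x≉0 , ord-x) x∈ = ℕₚ.1+n≰n (ℤₚ.drop‿+≤+ (≡.subst (_ ℤ.≤_) ord-x (x∈ x≉0)))

  ∈𝔭^∧¬OrdEq⇒∈𝔭^suc : x ∈𝔭^ n → ¬ OrdEq x (+ n) → x ∈𝔭^ suc n
  ∈𝔭^∧¬OrdEq⇒∈𝔭^suc {x} x∈ ¬eq x≉0 with ord x | x∈ x≉0
  ... | + k | ℤ.+≤+ n≤k = ℤ.+≤+ (ℕₚ.≤∧≢⇒< n≤k (λ n≡k → ¬eq (x≉0 , ≡.cong +_ (≡.sym n≡k))))

  ∈𝔭^∧∉𝔭^suc⇒OrdEq : x ∈𝔭^ n → ¬ x ∈𝔭^ suc n → OrdEq x (+ n)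
  ∈𝔭^∧∉𝔭^suc⇒OrdEq x∈ x∉ = OrdEq-stable (x∉ ∘ ∈𝔭^∧¬OrdEq⇒∈𝔭^suc x∈)

  OrdEq-+-∈𝔭^suc : OrdEq x (+ n) → y ∈𝔭^ suc n → OrdEq (x + y) (+ n)
  OrdEq-+-∈𝔭^suc {x} {n} {y} x-ord y∈ =
    ∈𝔭^∧∉𝔭^suc⇒OrdEq (∈𝔭^-+ (OrdEq⇒∈𝔭^ x-ord) (∈𝔭^-weaken (ℕₚ.n≤1+n n) y∈))
      (λ x+y∈ → OrdEq⇒∉𝔭^suc x-ord (∈𝔭^-resp-≈ [x+y]-y≈x (∈𝔭^-- x+y∈ y∈)))
    where
    [x+y]-y≈x : (x + y) - y ≈ x
    [x+y]-y≈x = solve 2 (λ x y → (x :+ y) :- y := x) refl x y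

  ∈𝔭^suc-+-OrdEq : x ∈𝔭^ suc n → OrdEq y (+ n) → OrdEq (x + y) (+ n)
  ∈𝔭^suc-+-OrdEq x∈ y-ord = OrdEq-resp-≈ (+-comm _ _) (OrdEq-+-∈𝔭^suc y-ord x∈)

  private
    square∈𝔭^⇒∈𝔭^ : ∀ k → (∀ j → n ≤ j +ℕ j → k ≤ j) → x * x ∈𝔭^ n → x ∈𝔭^ k
    square∈𝔭^⇒∈𝔭^ {n} {x} k halve xx∈ x≉0
      with ord x | ≡.subst (+ n ℤ.≤_) (ord-mul x x x≉0 x≉0) (xx∈ (*-nonzero x≉0 x≉0))
    ... | + j      | ℤ.+≤+ n≤j+j = ℤ.+≤+ (halve j n≤j+j)
    ... | -[1+ j ] | ()

  square∈𝔭^even⇒ : ∀ {k} → x * x ∈𝔭^ (k +ℕ k) → x ∈𝔭^ k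
  square∈𝔭^even⇒ {k = k} = square∈𝔭^⇒∈𝔭^ k λ j k+k≤j+j →
    ℕₚ.≮⇒≥ (λ j<k → ℕₚ.<⇒≱ (ℕₚ.+-mono-< j<k j<k) k+k≤j+j)

  square∈𝔭^odd⇒ : ∀ {k} → x * x ∈𝔭^ suc (k +ℕ k) → x ∈𝔭^ suc k
  square∈𝔭^odd⇒ {k = k} = square∈𝔭^⇒∈𝔭^ (suc k) λ j k+k<j+j →
    ℕₚ.≮⇒≥ (λ j≤k → ℕₚ.<⇒≱ k+k<j+j (ℕₚ.+-mono-≤ (ℕₚ.≤-pred j≤k) (ℕₚ.≤-pred j≤k)))

  OrdEq-^ : OrdEq x (+ 1) → ∀ n → OrdEq (x ^ n) (+ n)
  OrdEq-^ _     zero    = OrdEq-1#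
  OrdEq-^ x-ord (suc n) = OrdEq-* x-ord (OrdEq-^ x-ord n)

  unit-quotient : ∀ {g r} → OrdEq g (+ n) → OrdEq r (+ n) → Σ Carrier λ w → OrdEq w (+ 0) × g * w ≈ r
  unit-quotient {g = g} {r} (g≉0 , ord-g) (r≉0 , ord-r) with inverse g g≉0
  ... | g⁻¹ , gg⁻¹≈1 = g⁻¹ * r , (w≉0 , ord-w) , g[g⁻¹r]≈r
    where
    g[g⁻¹r]≈r : g * (g⁻¹ * r) ≈ r
    g[g⁻¹r]≈r = trans (sym (*-assoc g g⁻¹ r)) (trans (*-congʳ gg⁻¹≈1) (*-identityˡ r))
    w≉0 : ¬ g⁻¹ * r ≈ 0#
    w≉0 w≈0 = r≉0 (trans (sym g[g⁻¹r]≈r) (trans (*-congˡ w≈0) (zeroʳ g)))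
    ord-w : ord (g⁻¹ * r) ≡ + 0
    ord-w = ℤ-identityʳ-unique (ord g) (ord (g⁻¹ * r))
      (≡.trans (≡.sym (ord-mul g (g⁻¹ * r) g≉0 w≉0))
      (≡.trans (ord-cong g[g⁻¹r]≈r (*-nonzero g≉0 w≉0)) (≡.trans ord-r (≡.sym ord-g))))

  -- Square roots modulo 𝔭

  infixl 8 _²^_
  _²^_ : Carrier → ℕ → Carrier
  w ²^ zero  = w
  w ²^ suc n = w ²^ n * w ²^ n

  OrdEq-²^ : ∀ {w} → OrdEq w (+ 0) → ∀ n → OrdEq (w ²^ n) (+ 0)
  OrdEq-²^ w-unit zero    = w-unit
  OrdEq-²^ w-unit (suc n) = OrdEq-* (OrdEq-²^ w-unit n) (OrdEq-²^ w-unit n)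

  square-injective-mod-𝔭 : u ∈𝔭^ 0 → x ∈𝔭^ 0 → u * u - x * x ∈𝔭^ 1 → u - x ∈𝔭^ 1
  square-injective-mod-𝔭 {u} {x} u∈ x∈ uu-xx∈ = square∈𝔭^odd⇒ {k = 0}
    (∈𝔭^-resp-≈ (sym [u-x]²≈uu-xx-2x[u-x]) (∈𝔭^-- uu-xx∈ (∈𝔭^-* (∈𝔭^-* 2∈𝔭¹ x∈) (∈𝔭^-- u∈ x∈))))
    where
    [u-x]²≈uu-xx-2x[u-x] : (u - x) * (u - x) ≈ (u * u - x * x) - two * x * (u - x)
    [u-x]²≈uu-xx-2x[u-x] = solve 2
      (λ u x → (u :- x) :* (u :- x) := (u :* u :- x :* x) :- con (+ 2) :* x :* (u :- x)) refl u x

  ²^-injective-mod-𝔭 : ∀ {w} → OrdEq w (+ 0) → ∀ i d → w ²^ i - w ²^ (i +ℕ d) ∈𝔭^ 1 → w - w ²^ d ∈𝔭^ 1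
  ²^-injective-mod-𝔭 w-unit zero    d w-w²^d∈ = w-w²^d∈
  ²^-injective-mod-𝔭 w-unit (suc i) d ∈𝔭 = ²^-injective-mod-𝔭 w-unit i d
    (square-injective-mod-𝔭 (OrdEq⇒∈𝔭^ (OrdEq-²^ w-unit i)) (OrdEq⇒∈𝔭^ (OrdEq-²^ w-unit (i +ℕ d))) ∈𝔭)

  ²^-residues-collide : ∀ {w} → OrdEq w (+ 0) → ∃₂ λ i d → w ²^ i - w ²^ (i +ℕ suc d) ∈𝔭^ 1
  ²^-residues-collide {w} w-unit with residueFinite
  ... | k , rep , _ , cover = collide (Finₚ.pigeonhole (ℕₚ.n<1+n k) residue)
    where
    ²^-int : ∀ n → Int (w ²^ n)
    ²^-int n = OrdEq⇒OrdGE (OrdEq-²^ w-unit n)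
    residue : Fin (suc k) → Fin k
    residue l = proj₁ (cover (w ²^ toℕ l) (²^-int (toℕ l)))
    near : ∀ l → w ²^ toℕ l - rep (residue l) ∈𝔭^ 1
    near l = OrdGE⇒∈𝔭^ (proj₂ (cover (w ²^ toℕ l) (²^-int (toℕ l))))
    [x-ρ]-[y-ρ]≈x-y : ∀ x y ρ → (x - ρ) - (y - ρ) ≈ x - y
    [x-ρ]-[y-ρ]≈x-y = solve 3 (λ x y ρ → (x :- ρ) :- (y :- ρ) := x :- y) refl
    collide : ∃₂ (λ i j → i Fin.< j × residue i ≡ residue j) → ∃₂ λ i d → w ²^ i - w ²^ (i +ℕ suc d) ∈𝔭^ 1
    collide (i , j , i<j , same-residue) with ℕₚ.m≤n⇒∃[o]m+o≡n i<j
    ... | d , 1+i+d≡j = toℕ i , d ,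
      ≡.subst (λ n → w ²^ toℕ i - w ²^ n ∈𝔭^ 1) (≡.sym (≡.trans (ℕₚ.+-suc (toℕ i) d) 1+i+d≡j))
        (∈𝔭^-resp-≈ ([x-ρ]-[y-ρ]≈x-y _ _ _)
          (∈𝔭^-- (near i) (≡.subst (λ ρ → w ²^ toℕ j - rep ρ ∈𝔭^ 1) (≡.sym same-residue) (near j))))

  square-root-mod-𝔭 : ∀ {w} → OrdEq w (+ 0) → Σ Carrier λ y → y ∈𝔭^ 0 × y * y - w ∈𝔭^ 1
  square-root-mod-𝔭 {w} w-unit = root (²^-residues-collide w-unit)
    where
    root : ∃₂ (λ i d → w ²^ i - w ²^ (i +ℕ suc d) ∈𝔭^ 1) → Σ Carrier λ y → y ∈𝔭^ 0 × y * y - w ∈𝔭^ 1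
    root (i , d , collision) = w ²^ d , OrdEq⇒∈𝔭^ (OrdEq-²^ w-unit d) , yy-w∈
      where
      -[x-y]≈y-x : ∀ x y → - (x - y) ≈ y - x
      -[x-y]≈y-x = solve 2 (λ x y → :- (x :- y) := y :- x) refl
      w-yy∈ : w - w ²^ d * w ²^ d ∈𝔭^ 1
      w-yy∈ = ²^-injective-mod-𝔭 w-unit i (suc d) collision
      yy-w∈ : w ²^ d * w ²^ d - w ∈𝔭^ 1
      yy-w∈ = ∈𝔭^-resp-≈ (-[x-y]≈y-x w (w ²^ d * w ²^ d)) (-‿∈𝔭^ w-yy∈)

  -- Binary forms and GL₂(𝔬)-equivalence

  infix 4 _≈ₛ_
  _≈ₛ_ : Sym2 Carrier → Sym2 Carrier → Set ℓ
  B ≈ₛ B′ = b11 B ≈ b11 B′ × b12 B ≈ b12 B′ × b22 B ≈ b22 B′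

  det : Mat2 Carrier → Carrier
  det U = u11 U * u22 U - u12 U * u21 U

  -- −4 det B
  disc : Sym2 Carrier → Carrier
  disc B = twice (b12 B) * twice (b12 B) - (two * two) * (b11 B * b22 B)

  formValue : Carrier → Carrier → Carrier → Carrier → Carrier → Carrier
  formValue p h r x y = x * (x * p) + x * (y * h) + y * (y * r)

  -- Solver polynomials whose evaluations are definitionally congr, det, disc and formValue.
  private
    0ᴾ 1ᴾ 2ᴾ : ∀ {n} → Polynomial n
    0ᴾ = con (+ 0)
    1ᴾ = con (+ 1)
    2ᴾ = con (+ 2)

    congrᴾ : ∀ {n} → Mat2 (Polynomial n) → Sym2 (Polynomial n) → Sym2 (Polynomial n)
    congrᴾ (mat2 a b c d) (sym2 p q r) = sym2
      (a :* a :* p :+ 2ᴾ :* a :* c :* q :+ c :* c :* r)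
      (a :* b :* p :+ (a :* d :+ c :* b) :* q :+ c :* d :* r)
      (b :* b :* p :+ 2ᴾ :* b :* d :* q :+ d :* d :* r)

    detᴾ : ∀ {n} → Mat2 (Polynomial n) → Polynomial n
    detᴾ (mat2 a b c d) = a :* d :- b :* c

    discᴾ : ∀ {n} → Sym2 (Polynomial n) → Polynomial n
    discᴾ (sym2 p q r) = 2ᴾ :* q :* (2ᴾ :* q) :- 2ᴾ :* 2ᴾ :* (p :* r)

    formᴾ : ∀ {n} → Polynomial n → Polynomial n → Polynomial n → Polynomial n → Polynomial n → Polynomial n
    formᴾ p h r x y = x :* (x :* p) :+ x :* (y :* h) :+ y :* (y :* r)

    identityᴾ swapᴾ : ∀ {n} → Mat2 (Polynomial n)
    identityᴾ = mat2 1ᴾ 0ᴾ 0ᴾ 1ᴾ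
    swapᴾ     = mat2 0ᴾ 1ᴾ 1ᴾ 0ᴾ

  disc-congr : ∀ U B → disc (congr U B) ≈ (det U * det U) * disc B
  disc-congr (mat2 a b c d) (sym2 p q r) = solve 7
    (λ a b c d p q r → let U = mat2 a b c d; B = sym2 p q r in
      discᴾ (congrᴾ U B) := detᴾ U :* detᴾ U :* discᴾ B) refl a b c d p q r

  b22-congr : ∀ a b c d B → b22 (congr (mat2 a b c d) B) ≈ formValue (b11 B) (twice (b12 B)) (b22 B) b d
  b22-congr a b c d (sym2 p q r) = solve 7
    (λ a b c d p q r → b22 (congrᴾ (mat2 a b c d) (sym2 p q r)) := formᴾ p (2ᴾ :* q) r b d)
    refl a b c d p q r

  -- B = ᵗ(U⁻¹) (ᵗU B U) U⁻¹, and the first column of det U · U⁻¹ is (u₂₂, −u₂₁)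
  b11-from-congr : ∀ U B → let B′ = congr U B in
    (det U * det U) * b11 B ≈ formValue (b11 B′) (twice (b12 B′)) (b22 B′) (u22 U) (- u21 U)
  b11-from-congr (mat2 a b c d) (sym2 p q r) = solve 7
    (λ a b c d p q r → let U = mat2 a b c d; B′ = congrᴾ U (sym2 p q r) in
      detᴾ U :* detᴾ U :* p := formᴾ (b11 B′) (2ᴾ :* b12 B′) (b22 B′) d (:- c))
    refl a b c d p q r

  HalfOrdGE : Carrier → ℕ → Set ℓ
  HalfOrdGE h n = (h ≈ 0#) ⊎ (¬ h ≈ 0# × + n ℤ.≤ + 2 ℤ.* ord h)

  -- Membership in M((d1,d2)) up to double negation; half-integrality follows from the three
  -- conditions.
  InM𝔭 : Sym2 Carrier → ℕ → ℕ → Set ℓ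
  InM𝔭 B d1 d2 = b11 B ∈𝔭^ d1 × b22 B ∈𝔭^ d2 × twice (b12 B) * twice (b12 B) ∈𝔭^ (d1 +ℕ d2)

  private
    ord-square : ¬ x ≈ 0# → ord (x * x) ≡ + 2 ℤ.* ord x
    ord-square {x} x≉0 = ≡.trans (ord-mul x x x≉0 x≉0) (≡.sym (2*i≡i+i (ord x)))
      where
      2*i≡i+i : ∀ i → + 2 ℤ.* i ≡ i ℤ.+ i
      2*i≡i+i = ℤ-Tactic.solve-∀

  HalfOrdGE⇒square∈𝔭^ : HalfOrdGE x n → x * x ∈𝔭^ n
  HalfOrdGE⇒square∈𝔭^ {x} (inj₁ x≈0)          = ≈0⇒∈𝔭^ (trans (*-congʳ x≈0) (zeroˡ x))
  HalfOrdGE⇒square∈𝔭^     (inj₂ (x≉0 , n≤2x)) _ = ≡.subst (_ ℤ.≤_) (≡.sym (ord-square x≉0)) n≤2x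

  square∈𝔭^⇒¬¬HalfOrdGE : x * x ∈𝔭^ n → ¬ ¬ HalfOrdGE x n
  square∈𝔭^⇒¬¬HalfOrdGE xx∈ ¬ge =
    ¬ge (inj₂ (x≉0 , ≡.subst (_ ℤ.≤_) (ord-square x≉0) (xx∈ (*-nonzero x≉0 x≉0))))
    where x≉0 = ¬ge ∘ inj₁

  HalfOrdGE-resp-≈ : x ≈ y → HalfOrdGE x n → HalfOrdGE y n
  HalfOrdGE-resp-≈ x≈y (inj₁ x≈0)        = inj₁ (trans (sym x≈y) x≈0)
  HalfOrdGE-resp-≈ x≈y (inj₂ (x≉0 , n≤)) =
    inj₂ (x≉0 ∘ trans x≈y , ≡.subst (λ i → _ ℤ.≤ + 2 ℤ.* i) (ord-cong x≈y x≉0) n≤)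

  InM⇒InM𝔭 : ∀ {B d1 d2} → InM B d1 d2 → InM𝔭 B d1 d2
  InM⇒InM𝔭 (_ , p-ge , r-ge , h-ge) = OrdGE⇒∈𝔭^ p-ge , OrdGE⇒∈𝔭^ r-ge , HalfOrdGE⇒square∈𝔭^ h-ge

  InM𝔭⇒¬¬InM : ∀ {B d1 d2} → InM𝔭 B d1 d2 → ¬ ¬ InM B d1 d2
  InM𝔭⇒¬¬InM (p∈ , r∈ , hh∈) ¬inm =
    ∈𝔭^⇒¬¬OrdGE (∈𝔭^-weaken z≤n p∈) λ p-int →
    ∈𝔭^⇒¬¬OrdGE (∈𝔭^-weaken z≤n r∈) λ r-int →
    ∈𝔭^⇒¬¬OrdGE (square∈𝔭^even⇒ {k = 0} (∈𝔭^-weaken z≤n hh∈)) λ h-int →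
    ∈𝔭^⇒¬¬OrdGE p∈ λ p-ge →
    ∈𝔭^⇒¬¬OrdGE r∈ λ r-ge →
    square∈𝔭^⇒¬¬HalfOrdGE hh∈ λ h-ge →
    ¬inm ((p-int , r-int , h-int) , p-ge , r-ge , h-ge)

  InM-resp-≈ₛ : ∀ {B B′ d1 d2} → B ≈ₛ B′ → InM B d1 d2 → InM B′ d1 d2
  InM-resp-≈ₛ (p≈ , q≈ , r≈) ((p-int , r-int , h-int) , p-ge , r-ge , h-ge) =
    (OrdGE-resp-≈ p≈ p-int , OrdGE-resp-≈ r≈ r-int , OrdGE-resp-≈ (*-congˡ q≈) h-int) ,
    OrdGE-resp-≈ p≈ p-ge , OrdGE-resp-≈ r≈ r-ge , HalfOrdGE-resp-≈ (*-congˡ q≈) h-ge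

  Reach-by : ∀ {U B B′ d1 d2} → InGL2o U → B′ ≈ₛ congr U B → InM B′ d1 d2 → Reach B d1 d2
  Reach-by {U} U∈GL B′≈ inm = U , U∈GL , InM-resp-≈ₛ B′≈ inm

  private
    1-int : Int 1#
    1-int = OrdEq⇒OrdGE OrdEq-1#

    identity-InGL2o : InGL2o (mat2 1# 0# 0# 1#)
    identity-InGL2o = 1-int , inj₁ refl , inj₁ refl , 1-int ,
      OrdEq-resp-≈ (solve 0 (1ᴾ := detᴾ identityᴾ) refl) OrdEq-1#

    swap-InGL2o : InGL2o (mat2 0# 1# 1# 0#)
    swap-InGL2o = inj₁ refl , 1-int , 1-int , inj₁ refl ,
      OrdEq-resp-≈ (solve 0 (:- 1ᴾ := detᴾ swapᴾ) refl) OrdEq--1#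

  Reach-refl : ∀ {B d1 d2} → InM B d1 d2 → Reach B d1 d2
  Reach-refl {sym2 p q r} = Reach-by identity-InGL2o
    ( solve 3 (λ p q r → p := b11 (congrᴾ identityᴾ (sym2 p q r))) refl p q r
    , solve 3 (λ p q r → q := b12 (congrᴾ identityᴾ (sym2 p q r))) refl p q r
    , solve 3 (λ p q r → r := b22 (congrᴾ identityᴾ (sym2 p q r))) refl p q r )

  ¬¬Reach-refl : ∀ {B d1 d2} → InM𝔭 B d1 d2 → ¬ ¬ Reach B d1 d2
  ¬¬Reach-refl = ¬¬-map Reach-refl ∘ InM𝔭⇒¬¬InM

  ¬¬Reach-swap : ∀ {p q r d1 d2} → InM𝔭 (sym2 r q p) d1 d2 → ¬ ¬ Reach (sym2 p q r) d1 d2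
  ¬¬Reach-swap {p} {q} {r} = ¬¬-map (Reach-by swap-InGL2o
    ( solve 3 (λ p q r → r := b11 (congrᴾ swapᴾ (sym2 p q r))) refl p q r
    , solve 3 (λ p q r → q := b12 (congrᴾ swapᴾ (sym2 p q r))) refl p q r
    , solve 3 (λ p q r → p := b22 (congrᴾ swapᴾ (sym2 p q r))) refl p q r ))
    ∘ InM𝔭⇒¬¬InM

  -- The shear (1 x; 0 1) turns b₂₂ into b₁₁x² + (2b₁₂)x + b₂₂.  With x = t y, ord t = f and
  -- b₁₁t²w = b₂₂, this is b₁₁t²(y² − w) + t y (2b₁₂) + 2b₂₂, so y² ≡ w mod 𝔭 raises ord b₂₂.
  shear-InM𝔭 : ∀ {p q r a f t y w} → OrdEq p (+ a) → OrdEq t (+ f) → twice q ∈𝔭^ suc (f +ℕ a) →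
    r ∈𝔭^ (f +ℕ (f +ℕ a)) → y ∈𝔭^ 0 → y * y - w ∈𝔭^ 1 → t * (t * p) * w ≈ r →
    InM𝔭 (congr (mat2 1# (t * y) 0# 1#) (sym2 p q r)) a (suc (f +ℕ (f +ℕ a)))
  shear-InM𝔭 {p} {q} {r} {a} {f} {t} {y} {w} p-ord t-ord h∈ r∈ y∈ yy-w∈ tpw≈r = b11′∈ , b22′∈ , h′h′∈
    where
    B′ = congr (mat2 1# (t * y) 0# 1#) (sym2 p q r)
    shearᴾ : ∀ {n} → Polynomial n → Polynomial n → Mat2 (Polynomial n)
    shearᴾ t y = mat2 1ᴾ (t :* y) 0ᴾ 1ᴾ
    t∈ : t ∈𝔭^ f
    t∈ = OrdEq⇒∈𝔭^ t-ord
    b11′≈ : b11 B′ ≈ p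
    b11′≈ = solve 5 (λ p q r t y → b11 (congrᴾ (shearᴾ t y) (sym2 p q r)) := p) refl p q r t y
    h′≈ : twice (b12 B′) ≈ t * (y * twice p) + twice q
    h′≈ = solve 5 (λ p q r t y → 2ᴾ :* b12 (congrᴾ (shearᴾ t y) (sym2 p q r)) :=
            t :* (y :* (2ᴾ :* p)) :+ 2ᴾ :* q) refl p q r t y
    b22′≈ : b22 B′ ≈ (y * y - w) * (t * (t * p)) + t * (y * twice q) + (r + t * (t * p) * w)
    b22′≈ = solve 6 (λ p q r t y w → b22 (congrᴾ (shearᴾ t y) (sym2 p q r)) :=
              (y :* y :- w) :* (t :* (t :* p)) :+ t :* (y :* (2ᴾ :* q)) :+ (r :+ t :* (t :* p) :* w))
            refl p q r t y w
    r+r≈2r : r + r ≈ twice r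
    r+r≈2r = solve 1 (λ r → r :+ r := 2ᴾ :* r) refl r
    b11′∈ : b11 B′ ∈𝔭^ a
    b11′∈ = ∈𝔭^-resp-≈ (sym b11′≈) (OrdEq⇒∈𝔭^ p-ord)
    h′∈ : twice (b12 B′) ∈𝔭^ suc (f +ℕ a)
    h′∈ = ∈𝔭^-resp-≈ (sym h′≈)
      (∈𝔭^-+ (∈𝔭^-resp-≡ (ℕₚ.+-suc f a) (∈𝔭^-* t∈ (∈𝔭^-* y∈ (∈𝔭^-* 2∈𝔭¹ (OrdEq⇒∈𝔭^ p-ord))))) h∈)
    h′h′∈ : twice (b12 B′) * twice (b12 B′) ∈𝔭^ (a +ℕ suc (f +ℕ (f +ℕ a)))
    h′h′∈ = ∈𝔭^-weaken (ℕₚ.≤-trans (ℕₚ.n≤1+n _) (ℕₚ.≤-reflexive (≡.sym (exponents a f)))) (∈𝔭^-* h′∈ h′∈)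
      where
      exponents : ∀ a f → suc (f +ℕ a) +ℕ suc (f +ℕ a) ≡ suc (a +ℕ suc (f +ℕ (f +ℕ a)))
      exponents = ℕ-Tactic.solve-∀
    b22′∈ : b22 B′ ∈𝔭^ suc (f +ℕ (f +ℕ a))
    b22′∈ = ∈𝔭^-resp-≈ (sym b22′≈) (∈𝔭^-+ (∈𝔭^-+
      (∈𝔭^-* yy-w∈ (OrdEq⇒∈𝔭^ (OrdEq-* t-ord (OrdEq-* t-ord p-ord))))
      (∈𝔭^-resp-≡ (ℕₚ.+-suc f (f +ℕ a)) (∈𝔭^-* t∈ (∈𝔭^-* y∈ h∈))))
      (∈𝔭^-resp-≈ (sym (trans (+-congˡ tpw≈r) r+r≈2r)) (∈𝔭^-* 2∈𝔭¹ r∈)))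

  reach-shear : ∀ {p q r a} f → OrdEq p (+ a) → OrdEq r (+ (f +ℕ (f +ℕ a))) → twice q ∈𝔭^ suc (f +ℕ a) →
    ¬ ¬ Reach (sym2 p q r) a (suc (f +ℕ (f +ℕ a)))
  reach-shear {p} {q} {r} {a} f p-ord r-ord h∈ ¬reach =
    ∈𝔭^⇒¬¬OrdGE x∈ λ x-int →
    ¬¬-map (Reach-by (1-int , x-int , inj₁ refl , 1-int , det-unit) (refl , refl , refl))
      (InM𝔭⇒¬¬InM (shear-InM𝔭 p-ord t-ord h∈ (OrdEq⇒∈𝔭^ r-ord) y₀∈ y₀y₀-w∈ tpw≈r)) ¬reach
    where
    t : Carrier
    t = proj₁ uniformizer ^ f
    t-ord : OrdEq t (+ f)
    t-ord = OrdEq-^ (proj₂ uniformizer) f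
    quotient = unit-quotient (OrdEq-* t-ord (OrdEq-* t-ord p-ord)) r-ord
    w : Carrier
    w = proj₁ quotient
    tpw≈r : t * (t * p) * w ≈ r
    tpw≈r = proj₂ (proj₂ quotient)
    root = square-root-mod-𝔭 (proj₁ (proj₂ quotient))
    y₀ : Carrier
    y₀ = proj₁ root
    y₀∈ : y₀ ∈𝔭^ 0
    y₀∈ = proj₁ (proj₂ root)
    y₀y₀-w∈ : y₀ * y₀ - w ∈𝔭^ 1
    y₀y₀-w∈ = proj₂ (proj₂ root)
    x∈ : t * y₀ ∈𝔭^ 0
    x∈ = ∈𝔭^-weaken z≤n (∈𝔭^-*ʳ (OrdEq⇒∈𝔭^ t-ord) y₀∈)
    det-unit : OrdEq (1# * 1# - t * y₀ * 0#) (+ 0)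
    det-unit = OrdEq-resp-≈ (solve 1 (λ x → 1ᴾ := detᴾ (mat2 1ᴾ x 0ᴾ 1ᴾ)) refl (t * y₀)) OrdEq-1#

  -- Invariants of GL₂(𝔬)-equivalence

  formValue∈𝔭^ : ∀ {p h r} → p ∈𝔭^ n → h ∈𝔭^ n → r ∈𝔭^ n → x ∈𝔭^ 0 → y ∈𝔭^ 0 → formValue p h r x y ∈𝔭^ n
  formValue∈𝔭^ p∈ h∈ r∈ x∈ y∈ =
    ∈𝔭^-+ (∈𝔭^-+ (∈𝔭^-* x∈ (∈𝔭^-* x∈ p∈)) (∈𝔭^-* x∈ (∈𝔭^-* y∈ h∈))) (∈𝔭^-* y∈ (∈𝔭^-* y∈ r∈))

  Reach⇒disc∈𝔭^ : ∀ {B d1 d2} → Reach B d1 d2 → disc B ∈𝔭^ (d1 +ℕ d2)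
  Reach⇒disc∈𝔭^ {B} {d1} {d2} (U , (_ , _ , _ , _ , det-unit) , inm) with InM⇒InM𝔭 inm
  ... | p′∈ , r′∈ , h′h′∈ =
    ∈𝔭^-unit-cancelˡ (OrdEq-* det-unit det-unit) (∈𝔭^-resp-≈ (disc-congr U B) (∈𝔭^-- h′h′∈ 4p′r′∈))
    where
    4p′r′∈ : (two * two) * (b11 (congr U B) * b22 (congr U B)) ∈𝔭^ (d1 +ℕ d2)
    4p′r′∈ = ∈𝔭^-weaken (ℕₚ.m≤n+m (d1 +ℕ d2) 2) (∈𝔭^-* 4∈𝔭² (∈𝔭^-* p′∈ r′∈))

  Reach⇒b11∈𝔭^ : ∀ {B d1 d2} → Reach B d1 d2 → d1 ≤ d2 → b11 B ∈𝔭^ d1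
  Reach⇒b11∈𝔭^ {B} {d1} (U , (_ , _ , u₂₁-int , u₂₂-int , det-unit) , inm) d1≤d2 with InM⇒InM𝔭 inm
  ... | p′∈ , r′∈ , h′h′∈ =
    ∈𝔭^-unit-cancelˡ (OrdEq-* det-unit det-unit) (∈𝔭^-resp-≈ (sym (b11-from-congr U B))
      (formValue∈𝔭^ p′∈ h′∈ (∈𝔭^-weaken d1≤d2 r′∈) (OrdGE⇒∈𝔭^ u₂₂-int) (-‿∈𝔭^ (OrdGE⇒∈𝔭^ u₂₁-int))))
    where
    h′∈ : twice (b12 (congr U B)) ∈𝔭^ d1
    h′∈ = square∈𝔭^even⇒ (∈𝔭^-weaken (ℕₚ.+-monoʳ-≤ d1 d1≤d2) h′h′∈)

  OrdEq-disc : ∀ {p q r k} → OrdEq (twice q) (+ k) → p * r ∈𝔭^ (k +ℕ k) →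
    OrdEq (disc (sym2 p q r)) (+ (k +ℕ k))
  OrdEq-disc {k = k} h-ord pr∈ = OrdEq-+-∈𝔭^suc (OrdEq-* h-ord h-ord)
    (-‿∈𝔭^ (∈𝔭^-weaken (ℕₚ.n≤1+n (suc (k +ℕ k))) (∈𝔭^-* 4∈𝔭² pr∈)))

  -- If ord x = k ≤ f then p x² alone has the least valuation a + 2k; so x ∈ 𝔭^(f+1), and then
  -- y ∈ 𝔭, for otherwise r y² alone has the least valuation a + 2f + 1.
  formValue∈𝔭^⇒∈𝔭 : ∀ {p h r a f} →
    OrdEq p (+ a) → OrdEq r (+ suc (f +ℕ (f +ℕ a))) → h ∈𝔭^ suc (f +ℕ a) → x ∈𝔭^ 0 → y ∈𝔭^ 0 →
    formValue p h r x y ∈𝔭^ suc (suc (f +ℕ (f +ℕ a))) → x ∈𝔭^ 1 × y ∈𝔭^ 1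
  formValue∈𝔭^⇒∈𝔭 {x} {y} {p} {h} {r} {a} {f} p-ord r-ord h∈ x∈ y∈ Q∈ = x∈𝔭^ 1 (s≤s z≤n) , y∈𝔭
    where
    Q = formValue p h r x y
    OrdEq-Q : ∀ {k} → k ≤ f → OrdEq x (+ k) → OrdEq Q (+ (k +ℕ (k +ℕ a)))
    OrdEq-Q {k} k≤f x-ord = OrdEq-+-∈𝔭^suc (OrdEq-+-∈𝔭^suc (OrdEq-* x-ord (OrdEq-* x-ord p-ord)) xyh∈) yyr∈
      where
      xyh∈ : x * (y * h) ∈𝔭^ suc (k +ℕ (k +ℕ a))
      xyh∈ = ∈𝔭^-weaken (ℕₚ.≤-trans (s≤s (ℕₚ.+-monoʳ-≤ k (ℕₚ.+-monoˡ-≤ a k≤f)))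
                                    (ℕₚ.≤-reflexive (≡.sym (ℕₚ.+-suc k (f +ℕ a)))))
               (∈𝔭^-* (OrdEq⇒∈𝔭^ x-ord) (∈𝔭^-* y∈ h∈))
      yyr∈ : y * (y * r) ∈𝔭^ suc (k +ℕ (k +ℕ a))
      yyr∈ = ∈𝔭^-weaken (s≤s (ℕₚ.+-mono-≤ k≤f (ℕₚ.+-monoˡ-≤ a k≤f))) (∈𝔭^-* y∈ (∈𝔭^-* y∈ (OrdEq⇒∈𝔭^ r-ord)))
    x∈𝔭^ : ∀ k → k ≤ suc f → x ∈𝔭^ k
    x∈𝔭^ zero    _     = x∈
    x∈𝔭^ (suc k) k<1+f = ∈𝔭^-stable λ x∉ →
      OrdEq⇒∉𝔭^suc (OrdEq-Q k≤f (∈𝔭^∧∉𝔭^suc⇒OrdEq (x∈𝔭^ k (ℕₚ.<⇒≤ k<1+f)) x∉))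
        (∈𝔭^-weaken (s≤s (ℕₚ.m≤n⇒m≤1+n (ℕₚ.+-mono-≤ k≤f (ℕₚ.+-monoˡ-≤ a k≤f)))) Q∈)
      where k≤f = ℕₚ.≤-pred k<1+f
    [1+f]+[1+f+a]≡2+f+[f+a] : suc f +ℕ suc (f +ℕ a) ≡ suc (suc (f +ℕ (f +ℕ a)))
    [1+f]+[1+f+a]≡2+f+[f+a] = ≡.cong suc (ℕₚ.+-suc f (f +ℕ a))
    x∈𝔭^1+f : x ∈𝔭^ suc f
    x∈𝔭^1+f = x∈𝔭^ (suc f) ℕₚ.≤-refl
    xxp+xyh∈ : x * (x * p) + x * (y * h) ∈𝔭^ suc (suc (f +ℕ (f +ℕ a)))
    xxp+xyh∈ = ∈𝔭^-resp-≡ [1+f]+[1+f+a]≡2+f+[f+a]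
      (∈𝔭^-+ (∈𝔭^-* x∈𝔭^1+f (∈𝔭^-* x∈𝔭^1+f (OrdEq⇒∈𝔭^ p-ord))) (∈𝔭^-* x∈𝔭^1+f (∈𝔭^-* y∈ h∈)))
    y∈𝔭 : y ∈𝔭^ 1
    y∈𝔭 = ∈𝔭^-stable λ y∉ →
      let y-ord = ∈𝔭^∧∉𝔭^suc⇒OrdEq y∈ y∉
      in OrdEq⇒∉𝔭^suc (∈𝔭^suc-+-OrdEq xxp+xyh∈ (OrdEq-* y-ord (OrdEq-* y-ord r-ord))) Q∈

  ¬Reach-beyond-disc : ∀ {B m d1 d2} → OrdEq (disc B) (+ m) → m < d1 +ℕ d2 → ¬ Reach B d1 d2
  ¬Reach-beyond-disc disc-ord m<d reach = OrdEq⇒∉𝔭^suc disc-ord (∈𝔭^-weaken m<d (Reach⇒disc∈𝔭^ reach))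

  ¬Reach-above-b11 : ∀ {p q r a d1 d2} → OrdEq p (+ a) → a < d1 → d1 ≤ d2 → ¬ Reach (sym2 p q r) d1 d2
  ¬Reach-above-b11 p-ord a<d1 d1≤d2 reach = OrdEq⇒∉𝔭^suc p-ord (∈𝔭^-weaken a<d1 (Reach⇒b11∈𝔭^ reach d1≤d2))

  ¬Reach-beyond-b22 : ∀ {p q r a f d1 d2} →
    OrdEq p (+ a) → OrdEq r (+ suc (f +ℕ (f +ℕ a))) → twice q ∈𝔭^ suc (f +ℕ a) →
    suc (suc (f +ℕ (f +ℕ a))) ≤ d2 → ¬ Reach (sym2 p q r) d1 d2
  ¬Reach-beyond-b22 {p} {q} {r} {a} {f} p-ord r-ord h∈ e<d2
    (mat2 u₁₁ u₁₂ u₂₁ u₂₂ , (u₁₁-int , u₁₂-int , u₂₁-int , u₂₂-int , det-unit) , inm) =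
    OrdEq⇒∉𝔭^suc det-unit (∈𝔭^-- (∈𝔭^-* (OrdGE⇒∈𝔭^ u₁₁-int) (proj₂ u₁₂,u₂₂∈𝔭))
                                  (∈𝔭^-*ʳ (proj₁ u₁₂,u₂₂∈𝔭) (OrdGE⇒∈𝔭^ u₂₁-int)))
    where
    b22′∈ : formValue p (twice q) r u₁₂ u₂₂ ∈𝔭^ suc (suc (f +ℕ (f +ℕ a)))
    b22′∈ = ∈𝔭^-resp-≈ (b22-congr u₁₁ u₁₂ u₂₁ u₂₂ (sym2 p q r))
              (∈𝔭^-weaken e<d2 (proj₁ (proj₂ (InM⇒InM𝔭 inm))))
    u₁₂,u₂₂∈𝔭 : u₁₂ ∈𝔭^ 1 × u₂₂ ∈𝔭^ 1
    u₁₂,u₂₂∈𝔭 = formValue∈𝔭^⇒∈𝔭 p-ord r-ord h∈ (OrdGE⇒∈𝔭^ u₁₂-int) (OrdGE⇒∈𝔭^ u₂₂-int) b22′∈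

  -- The Gross–Keating invariant

  IsGK-intro : ∀ {B a1 a2} → a1 ≤ a2 → InM B a1 a2 →
    (∀ {d1 d2} → a1 < d1 → d1 ≤ d2 → ¬ Reach B d1 d2) → (∀ {d2} → a2 < d2 → ¬ Reach B a1 d2) →
    IsGK B a1 a2
  IsGK-intro {B} {a1} {a2} a1≤a2 inm above right = a1≤a2 , Reach-refl inm , maximal
    where
    maximal : ∀ d1 d2 → d1 ≤ d2 → Reach B d1 d2 → LexLE d1 d2 a1 a2
    maximal d1 d2 d1≤d2 reach with ℕₚ.<-cmp d1 a1
    ... | tri< d1<a1 _ _ = inj₁ d1<a1
    ... | tri> _ _ a1<d1 = contradiction reach (above a1<d1 d1≤d2)
    ... | tri≈ _ ≡.refl _ with d2 ℕ.≤? a2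
    ...   | yes d2≤a2 = inj₂ (≡.refl , d2≤a2)
    ...   | no  d2≰a2 = contradiction reach (right (ℕₚ.≰⇒> d2≰a2))

  IsGK⇒¬Reach-above : ∀ {B a1 a2 d1 d2} → IsGK B a1 a2 → a1 < d1 → d1 ≤ d2 → ¬ Reach B d1 d2
  IsGK⇒¬Reach-above (_ , _ , maximal) a1<d1 d1≤d2 reach with maximal _ _ d1≤d2 reach
  ... | inj₁ d1<a1       = ℕₚ.<-asym a1<d1 d1<a1
  ... | inj₂ (d1≡a1 , _) = ℕₚ.<-irrefl (≡.sym d1≡a1) a1<d1

  IsGK⇒¬Reach-right : ∀ {B a1 a2 d2} → IsGK B a1 a2 → a2 < d2 → ¬ Reach B a1 d2
  IsGK⇒¬Reach-right (a1≤a2 , _ , maximal) a2<d2 reach with maximal _ _ (ℕₚ.≤-trans a1≤a2 (ℕₚ.<⇒≤ a2<d2)) reach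
  ... | inj₁ a1<a1       = ℕₚ.<-irrefl ≡.refl a1<a1
  ... | inj₂ (_ , d2≤a2) = ℕₚ.<⇒≱ a2<d2 d2≤a2

  private
    [a+f]+[a+f]≡a+[a+2f] : ∀ a f → (a +ℕ f) +ℕ (a +ℕ f) ≡ a +ℕ (a +ℕ 2 *ℕ f)
    [a+f]+[a+f]≡a+[a+2f] = ℕ-Tactic.solve-∀
    [1+a]+[1+a]≡a+[2+a] : ∀ a → suc a +ℕ suc a ≡ a +ℕ (2 +ℕ a)
    [1+a]+[1+a]≡a+[2+a] = ℕ-Tactic.solve-∀
    [1+a+f]+[1+a+f]≡1+a+[1+a+2f] : ∀ a f → suc (a +ℕ f) +ℕ suc (a +ℕ f) ≡ suc (a +ℕ suc (a +ℕ 2 *ℕ f))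
    [1+a+f]+[1+a+f]≡1+a+[1+a+2f] = ℕ-Tactic.solve-∀
    a+2f≡f+[f+a] : ∀ a f → a +ℕ 2 *ℕ f ≡ f +ℕ (f +ℕ a)
    a+2f≡f+[f+a] = ℕ-Tactic.solve-∀
    a+[a+[2f+1]]≡1+[f+a]+[f+a] : ∀ a f → a +ℕ (a +ℕ (2 *ℕ f +ℕ 1)) ≡ suc ((f +ℕ a) +ℕ (f +ℕ a))
    a+[a+[2f+1]]≡1+[f+a]+[f+a] = ℕ-Tactic.solve-∀
    a+[2f+1]≡1+f+[f+a] : ∀ a f → a +ℕ (2 *ℕ f +ℕ 1) ≡ suc (f +ℕ (f +ℕ a))
    a+[2f+1]≡1+f+[f+a] = ℕ-Tactic.solve-∀
    [1+f+a]+[1+f+a]≡a+[1+a+[2f+1]] : ∀ a f → suc (f +ℕ a) +ℕ suc (f +ℕ a) ≡ a +ℕ suc (a +ℕ (2 *ℕ f +ℕ 1))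
    [1+f+a]+[1+f+a]≡a+[1+a+[2f+1]] = ℕ-Tactic.solve-∀

  module _ {p q r : Carrier} where
    private
      B = sym2 p q r
      h = twice q

    GK-equal⇐ : ∀ {a} → InM B a a → OrdEq h (+ a) → IsGK B a a
    GK-equal⇐ {a} inm h-ord = IsGK-intro ℕₚ.≤-refl inm
      (λ a<d1 d1≤d2 → ¬Reach-beyond-disc disc-ord (ℕₚ.+-mono-< a<d1 (ℕₚ.<-≤-trans a<d1 d1≤d2)))
      (λ a<d2 → ¬Reach-beyond-disc disc-ord (ℕₚ.+-monoʳ-< a a<d2))
      where
      disc-ord : OrdEq (disc B) (+ (a +ℕ a))
      disc-ord = OrdEq-disc h-ord (∈𝔭^-* (proj₁ (InM⇒InM𝔭 inm)) (proj₁ (proj₂ (InM⇒InM𝔭 inm))))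

    GK-equal⇒ : ∀ {a} → InM𝔭 B a a → IsGK B a a → OrdEq h (+ a)
    GK-equal⇒ {a} (p∈ , r∈ , hh∈) gk = ∈𝔭^∧∉𝔭^suc⇒OrdEq (square∈𝔭^even⇒ hh∈) h∉
      where
      ¬reach : ¬ Reach B a (suc a)
      ¬reach = IsGK⇒¬Reach-right gk (ℕₚ.n<1+n a)
      h∉ : ¬ h ∈𝔭^ suc a
      h∉ h∈ = reach-shear 0 p-ord r-ord h∈ ¬reach
        where
        hh∈′ : h * h ∈𝔭^ (a +ℕ suc a)
        hh∈′ = ∈𝔭^-weaken (ℕₚ.+-monoˡ-≤ (suc a) (ℕₚ.n≤1+n a)) (∈𝔭^-* h∈ h∈)
        r-ord : OrdEq r (+ a)
        r-ord = ∈𝔭^∧∉𝔭^suc⇒OrdEq r∈ λ r∈′ → ¬¬Reach-refl (p∈ , r∈′ , hh∈′) ¬reach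
        p-ord : OrdEq p (+ a)
        p-ord = ∈𝔭^∧∉𝔭^suc⇒OrdEq p∈ λ p∈′ → ¬¬Reach-swap (r∈ , p∈′ , hh∈′) ¬reach

    GK-even⇐ : ∀ {a1 f} → InM B a1 (a1 +ℕ 2 *ℕ f) → OrdEq p (+ a1) → OrdEq h (+ (a1 +ℕ f)) →
      IsGK B a1 (a1 +ℕ 2 *ℕ f)
    GK-even⇐ {a1} {f} inm p-ord h-ord = IsGK-intro (ℕₚ.m≤m+n a1 _) inm (¬Reach-above-b11 p-ord)
      (λ {d2} a2<d2 → ¬Reach-beyond-disc disc-ord
        (≡.subst (_< a1 +ℕ d2) (≡.sym ([a+f]+[a+f]≡a+[a+2f] a1 f)) (ℕₚ.+-monoʳ-< a1 a2<d2)))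
      where
      disc-ord : OrdEq (disc B) (+ ((a1 +ℕ f) +ℕ (a1 +ℕ f)))
      disc-ord = OrdEq-disc h-ord (∈𝔭^-resp-≡ (≡.sym ([a+f]+[a+f]≡a+[a+2f] a1 f))
        (∈𝔭^-* (proj₁ (InM⇒InM𝔭 inm)) (proj₁ (proj₂ (InM⇒InM𝔭 inm)))))

    GK-even⇒ : ∀ {a1} f → 1 ≤ f → InM𝔭 B a1 (a1 +ℕ 2 *ℕ f) → IsGK B a1 (a1 +ℕ 2 *ℕ f) →
      OrdEq p (+ a1) × OrdEq h (+ (a1 +ℕ f))
    GK-even⇒ {a1} f 1≤f (p∈ , r∈ , hh∈) gk = p-ord , h-ord
      where
      a2 = a1 +ℕ 2 *ℕ f
      2+a1≤a2 : 2 +ℕ a1 ≤ a2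
      2+a1≤a2 = ≡.subst (_≤ a2) (ℕₚ.+-comm a1 2) (ℕₚ.+-monoʳ-≤ a1 (ℕₚ.*-monoʳ-≤ 2 1≤f))
      p-ord : OrdEq p (+ a1)
      p-ord = ∈𝔭^∧∉𝔭^suc⇒OrdEq p∈ λ p∈′ → ¬¬Reach-refl
        ( p∈′
        , ∈𝔭^-weaken (ℕₚ.<⇒≤ 2+a1≤a2) r∈
        , ∈𝔭^-weaken (≡.subst (_≤ a1 +ℕ a2) (≡.sym ([1+a]+[1+a]≡a+[2+a] a1)) (ℕₚ.+-monoʳ-≤ a1 2+a1≤a2)) hh∈ )
        (IsGK⇒¬Reach-above gk (ℕₚ.n<1+n a1) ℕₚ.≤-refl)
      h∉ : ¬ h ∈𝔭^ suc (a1 +ℕ f)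
      h∉ h∈ = reach-shear f p-ord (≡.subst (λ n → OrdEq r (+ n)) (a+2f≡f+[f+a] a1 f) r-ord)
          (≡.subst (λ n → h ∈𝔭^ suc n) (ℕₚ.+-comm a1 f) h∈)
          (IsGK⇒¬Reach-right gk (ℕₚ.≤-reflexive (≡.cong suc (a+2f≡f+[f+a] a1 f))))
        where
        hh∈′ : h * h ∈𝔭^ (a1 +ℕ suc a2)
        hh∈′ = ∈𝔭^-weaken
          (ℕₚ.≤-trans (ℕₚ.n≤1+n _) (ℕₚ.≤-reflexive (≡.sym ([1+a+f]+[1+a+f]≡1+a+[1+a+2f] a1 f))))
          (∈𝔭^-* h∈ h∈)
        r-ord : OrdEq r (+ a2)
        r-ord = ∈𝔭^∧∉𝔭^suc⇒OrdEq r∈ λ r∈′ →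
          ¬¬Reach-refl (p∈ , r∈′ , hh∈′) (IsGK⇒¬Reach-right gk (ℕₚ.n<1+n a2))
      h-ord : OrdEq h (+ (a1 +ℕ f))
      h-ord = ∈𝔭^∧∉𝔭^suc⇒OrdEq (square∈𝔭^even⇒ (∈𝔭^-resp-≡ (≡.sym ([a+f]+[a+f]≡a+[a+2f] a1 f)) hh∈)) h∉

    odd-h∈ : ∀ {a1} f → h * h ∈𝔭^ (a1 +ℕ (a1 +ℕ (2 *ℕ f +ℕ 1))) → h ∈𝔭^ suc (f +ℕ a1)
    odd-h∈ {a1} f hh∈ = square∈𝔭^odd⇒ (∈𝔭^-resp-≡ (a+[a+[2f+1]]≡1+[f+a]+[f+a] a1 f) hh∈)

    GK-odd⇐ : ∀ {a1} f → InM B a1 (a1 +ℕ (2 *ℕ f +ℕ 1)) → OrdEq p (+ a1) → OrdEq r (+ (a1 +ℕ (2 *ℕ f +ℕ 1))) →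
      IsGK B a1 (a1 +ℕ (2 *ℕ f +ℕ 1))
    GK-odd⇐ {a1} f inm p-ord r-ord = IsGK-intro (ℕₚ.m≤m+n a1 _) inm (¬Reach-above-b11 p-ord)
      (λ {d2} a2<d2 → ¬Reach-beyond-b22 p-ord (≡.subst (λ n → OrdEq r (+ n)) (a+[2f+1]≡1+f+[f+a] a1 f) r-ord)
        (odd-h∈ f (proj₂ (proj₂ (InM⇒InM𝔭 inm)))) (≡.subst (_< d2) (a+[2f+1]≡1+f+[f+a] a1 f) a2<d2))

    GK-odd⇒ : ∀ {a1} f → InM𝔭 B a1 (a1 +ℕ (2 *ℕ f +ℕ 1)) → IsGK B a1 (a1 +ℕ (2 *ℕ f +ℕ 1)) →
      OrdEq p (+ a1) × OrdEq r (+ (a1 +ℕ (2 *ℕ f +ℕ 1)))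
    GK-odd⇒ {a1} f (p∈ , r∈ , hh∈) gk = p-ord , r-ord
      where
      a2 = a1 +ℕ (2 *ℕ f +ℕ 1)
      hh∈′ : h * h ∈𝔭^ (suc (f +ℕ a1) +ℕ suc (f +ℕ a1))
      hh∈′ = ∈𝔭^-* (odd-h∈ f hh∈) (odd-h∈ f hh∈)
      1+a1≤1+f+a1 : suc a1 ≤ suc (f +ℕ a1)
      1+a1≤1+f+a1 = s≤s (ℕₚ.m≤n+m a1 f)
      p-ord : OrdEq p (+ a1)
      p-ord = ∈𝔭^∧∉𝔭^suc⇒OrdEq p∈ λ p∈′ → ¬¬Reach-refl
        ( p∈′
        , ∈𝔭^-weaken (ℕₚ.≤-trans (s≤s (ℕₚ.≤-trans (ℕₚ.m≤n+m a1 f) (ℕₚ.m≤n+m (f +ℕ a1) f)))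
                         (ℕₚ.≤-reflexive (≡.sym (a+[2f+1]≡1+f+[f+a] a1 f)))) r∈
        , ∈𝔭^-weaken (ℕₚ.+-mono-≤ 1+a1≤1+f+a1 1+a1≤1+f+a1) hh∈′ )
        (IsGK⇒¬Reach-above gk (ℕₚ.n<1+n a1) ℕₚ.≤-refl)
      r-ord : OrdEq r (+ a2)
      r-ord = ∈𝔭^∧∉𝔭^suc⇒OrdEq r∈ λ r∈′ → ¬¬Reach-refl
        (p∈ , r∈′ , ∈𝔭^-resp-≡ ([1+f+a]+[1+f+a]≡a+[1+a+[2f+1]] a1 f) hh∈′)
        (IsGK⇒¬Reach-right gk (ℕₚ.n<1+n a2))

proposition2p3 : ∀ {c ℓ : Level} (K : DyadicLocalField c ℓ) →
    let open DyadicLocalField K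
        open DLF K
    in ∀ (b11 b12 b22 : Carrier) (a1 a2 : ℕ) →
       InM (sym2 b11 b12 b22) a1 a2 →
       Nondegenerate (sym2 b11 b12 b22) →
       a1 ≤ a2 →
       ((a1 ≡ a2 →
          (IsGK (sym2 b11 b12 b22) a1 a2 ⇔ OrdEq (twice b12) (+ a1)))
       × (∀ (f : ℕ) → 1 ≤ f → a2 ≡ a1 +ℕ 2 *ℕ f →
          (IsGK (sym2 b11 b12 b22) a1 a2 ⇔
             (OrdEq b11 (+ a1) × OrdEq (twice b12) (+ (a1 +ℕ f)))))
       × (∀ (f : ℕ) → a2 ≡ a1 +ℕ (2 *ℕ f +ℕ 1) →
          (IsGK (sym2 b11 b12 b22) a1 a2 ⇔
             (OrdEq b11 (+ a1) × OrdEq b22 (+ a2)))))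
proposition2p3 K b11 b12 b22 a1 a2 inm _ _ =
    (λ { ≡.refl → mk⇔ (GK-equal⇒ inm𝔭) (GK-equal⇐ inm) })
  , (λ { f 1≤f ≡.refl → mk⇔ (GK-even⇒ f 1≤f inm𝔭) (λ (p-ord , h-ord) → GK-even⇐ inm p-ord h-ord) })
  , (λ { f ≡.refl → mk⇔ (GK-odd⇒ f inm𝔭) (λ (p-ord , r-ord) → GK-odd⇐ f inm p-ord r-ord) })
  where
  open Dyadic K
  inm𝔭 = InM⇒InM𝔭 inm
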